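{- Let $n\ge 2$ be an integer such that $p=4n-1$ is prime, and for $0\le j\le p$ let $\Gamma(j)=r_p((j-1)^2)+r_p(j+1-3n)$. Let $2\le k\le n+2$. (a) If $r_p((k-1)^2)<3n-k-1$, then $\Gamma(k)<p$ and $\Gamma(p+2-k)<p$. (b) If $3n-k-1\le r_p((k-1)^2)<3n+k-3$, then $\Gamma(p+2-k)<p\le\Gamma(k)$. (c) If $3n+k-3\le r_p((k-1)^2)$, then $p\le\Gamma(p+2-k)$ and $p\le\Gamma(k)$.
   Context: For a positive integer $q$ and $x\in\mathbb{Z}$, $r_q(x)\in\{0,1,\dots,q-1\}$ denotes the remainder of $x$ upon division by $q$. -}

module Defs where

open import Data.Nat using (ℕ; suc; NonZero)
import Data.Nat as ℕ
open import Data.Integer using (ℤ; +_; _-_; _+_; _*_)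
open import Data.Integer.DivMod using (_%ℕ_)

r : (q : ℕ) → .{{NonZero q}} → ℤ → ℕ
r q x = x %ℕ q

Γ : (n : ℕ) → .{{NonZero (4 ℕ.* n ℕ.∸ 1)}} → ℕ → ℕ
Γ n j = r p ((+ j - + 1) * (+ j - + 1)) ℕ.+ r p (+ j + + 1 - + (3 ℕ.* n))
  where p = 4 ℕ.* n ℕ.∸ 1

-- Both values of Γ share the first summand ρ = r_p((k-1)²), because p + 2 - k - 1 ≡ -(k - 1)
-- (mod p). The second summands are explicit: k + 1 - 3n lies in (-p, 0), so its remainder is
-- p - (3n - k - 1) = n + k, while p + 3 - k - 3n = n + 2 - k already lies in [0, p). Hence
-- Γ(k) = ρ + (n + k) and Γ(p + 2 - k) = ρ + (n + 2 - k), and the thresholds 3n - k - 1 and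
-- 3n + k - 3 of the three cases are exactly p minus these second summands.
module Submission where

open import Defs
open import Data.Nat using (ℕ; _+_; _*_; _∸_; _≤_; _<_; NonZero)
open import Data.Nat.Primality using (Prime)
open import Data.Product using (_×_)
open import Data.Integer using (+_; _-_)

open import Data.Nat using (suc; s≤s; z≤n)
open import Data.Nat.Properties
open import Data.Nat.DivMod using (_%_; m<n⇒m%n≡m; [m+kn]%n≡m%n)
open import Data.Nat.Tactic.RingSolver using (solve-∀)
open import Data.Product using (_,_)
import Data.Integer as ℤ
import Data.Integer.Properties as ℤ
open import Relation.Binary.PropositionalEquality

%-sq-complement : ∀ s t d .{{_ : NonZero d}} → s + t ≡ d → (s * s) % d ≡ (t * t) % d
%-sq-complement s t d refl = begin
  (s * s) % d                    ≡⟨ sym ([m+kn]%n≡m%n (s * s) (2 * t) d) ⟩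
  (s * s + 2 * t * d) % d        ≡⟨ cong (_% d) (expand s t) ⟩
  (t * t + d * d) % d            ≡⟨ [m+kn]%n≡m%n (t * t) d d ⟩
  (t * t) % d                    ∎
  where
  open ≡-Reasoning
  expand : ∀ s t → s * s + 2 * t * (s + t) ≡ t * t + (s + t) * (s + t)
  expand = solve-∀

r-pos : ∀ d .{{_ : NonZero d}} {x} → x < d → r d (+ x) ≡ x
r-pos d x<d = m<n⇒m%n≡m x<d

r-neg : ∀ d .{{_ : NonZero d}} {x} → 0 < x → x < d → r d (ℤ.- + x) ≡ d ∸ x
r-neg d {suc x} _ x<d rewrite m<n⇒m%n≡m x<d = refl

sqRem : (d : ℕ) .{{_ : NonZero d}} → ℕ → ℕ
sqRem d j = r d ((+ j - + 1) ℤ.* (+ j - + 1))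

sqRem-reflect : ∀ d .{{_ : NonZero d}} {j k} → j + k ≡ d + 2 → 1 ≤ j → 1 ≤ k →
                sqRem d j ≡ sqRem d k
sqRem-reflect d {suc j} {suc k} j+k≡d+2 _ _ = begin
  r d (+ j ℤ.* + j) ≡⟨ cong (r d) (sym (ℤ.pos-* j j)) ⟩
  (j * j) % d       ≡⟨ %-sq-complement j k d j+k≡d ⟩
  (k * k) % d       ≡⟨ cong (r d) (ℤ.pos-* k k) ⟩
  r d (+ k ℤ.* + k) ∎
  where
  open ≡-Reasoning
  shift : ∀ j k → j + k + 2 ≡ suc j + suc k
  shift = solve-∀
  j+k≡d : j + k ≡ d
  j+k≡d = +-cancelʳ-≡ 2 (j + k) d (trans (shift j k) j+k≡d+2)

+-<-complement : ∀ {a c m x} → a + c ≡ m → x < a → x + c < m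
+-<-complement {c = c} a+c≡m x<a = subst (_ <_) a+c≡m (+-monoˡ-< c x<a)

+-≥-complement : ∀ {a c m x} → a + c ≡ m → a ≤ x → m ≤ x + c
+-≥-complement {c = c} a+c≡m a≤x = subst (_≤ _) a+c≡m (+-monoˡ-≤ c a≤x)

module Γ-values (n : ℕ) .{{_ : NonZero (4 * n ∸ 1)}} (1≤n : 1 ≤ n) where

  private
    p : ℕ
    p = 4 * n ∸ 1

    p+1≡4n : p + 1 ≡ 4 * n
    p+1≡4n = m∸n+n≡m (≤-trans 1≤n (m≤n*m n 4))

  [3n∸k∸1]+[n+k]≡p : ∀ k → k + 1 ≤ 3 * n → (3 * n ∸ k ∸ 1) + (n + k) ≡ p
  [3n∸k∸1]+[n+k]≡p k k+1≤3n = begin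
    (3 * n ∸ k ∸ 1) + (n + k)   ≡⟨ cong (_+ (n + k)) (∸-+-assoc (3 * n) k 1) ⟩
    (3 * n ∸ (k + 1)) + (n + k) ≡⟨ +-∸-comm (n + k) k+1≤3n ⟨
    (3 * n + (n + k)) ∸ (k + 1) ≡⟨ cong (_∸ (k + 1)) (regroup n k) ⟩
    (k + 4 * n) ∸ (k + 1)       ≡⟨ [m+n]∸[m+o]≡n∸o k (4 * n) 1 ⟩
    p                           ∎
    where
    open ≡-Reasoning
    regroup : ∀ n k → 3 * n + (n + k) ≡ k + 4 * n
    regroup = solve-∀

  [3n+k∸3]+[n+2∸k]≡p : ∀ k → k ≤ n + 2 → (3 * n + k ∸ 3) + (n + 2 ∸ k) ≡ p
  [3n+k∸3]+[n+2∸k]≡p k k≤n+2 = begin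
    (3 * n + k ∸ 3) + (n + 2 ∸ k)   ≡⟨ +-∸-comm (n + 2 ∸ k) 3≤3n+k ⟨
    (3 * n + k + (n + 2 ∸ k)) ∸ 3   ≡⟨ cong (_∸ 3) (+-assoc (3 * n) k (n + 2 ∸ k)) ⟩
    (3 * n + (k + (n + 2 ∸ k))) ∸ 3 ≡⟨ cong (λ x → (3 * n + x) ∸ 3) (m+[n∸m]≡n k≤n+2) ⟩
    (3 * n + (n + 2)) ∸ 3           ≡⟨ cong (_∸ 3) (regroup n) ⟩
    (2 + 4 * n) ∸ (2 + 1)           ≡⟨ [m+n]∸[m+o]≡n∸o 2 (4 * n) 1 ⟩
    p                               ∎
    where
    open ≡-Reasoning
    3≤3n+k : 3 ≤ 3 * n + k
    3≤3n+k = ≤-trans (*-monoʳ-≤ 3 1≤n) (m≤m+n (3 * n) k)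
    regroup : ∀ n → 3 * n + (n + 2) ≡ 2 + 4 * n
    regroup = solve-∀

  Γ[k]≡ρ+[n+k] : ∀ k → k + 1 < 3 * n → Γ n k ≡ sqRem p k + (n + k)
  Γ[k]≡ρ+[n+k] k k+1<3n = cong (λ x → sqRem p k + x) (begin
    r p (+ (k + 1) - + (3 * n))  ≡⟨ cong (r p) (trans (ℤ.m-n≡m⊖n (k + 1) (3 * n)) (ℤ.⊖-≤ k+1≤3n)) ⟩
    r p (ℤ.- + (3 * n ∸ (k + 1))) ≡⟨ cong (λ x → r p (ℤ.- + x)) (∸-+-assoc (3 * n) k 1) ⟨
    r p (ℤ.- + a)                ≡⟨ r-neg p 0<a a<p ⟩
    p ∸ a                        ≡⟨ cong (_∸ a) a+[n+k]≡p ⟨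
    (a + (n + k)) ∸ a            ≡⟨ m+n∸m≡n a (n + k) ⟩
    n + k                        ∎)
    where
    open ≡-Reasoning
    a : ℕ
    a = 3 * n ∸ k ∸ 1
    k+1≤3n : k + 1 ≤ 3 * n
    k+1≤3n = <⇒≤ k+1<3n
    a+[n+k]≡p : a + (n + k) ≡ p
    a+[n+k]≡p = [3n∸k∸1]+[n+k]≡p k k+1≤3n
    0<a : 0 < a
    0<a = subst (0 <_) (sym (∸-+-assoc (3 * n) k 1)) (m<n⇒0<n∸m k+1<3n)
    a<p : a < p
    a<p = subst (a <_) a+[n+k]≡p (m<m+n a (≤-trans 1≤n (m≤m+n n k)))

  Γ[p+2∸k]≡ρ+[n+2∸k] : ∀ k → 1 ≤ k → k ≤ n + 2 → Γ n (p + 2 ∸ k) ≡ sqRem p k + (n + 2 ∸ k)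
  Γ[p+2∸k]≡ρ+[n+2∸k] k 1≤k k≤n+2 = cong₂ _+_ (sqRem-reflect p j+k≡p+2 1≤j 1≤k) (begin
    r p (+ (j + 1) - + (3 * n))  ≡⟨ cong (r p) (trans (ℤ.m-n≡m⊖n (j + 1) (3 * n)) (ℤ.⊖-≥ 3n≤j+1)) ⟩
    r p (+ (j + 1 ∸ 3 * n))      ≡⟨ cong (λ x → r p (+ (x ∸ 3 * n))) j+1≡e+3n ⟩
    r p (+ (e + 3 * n ∸ 3 * n))  ≡⟨ cong (λ x → r p (+ x)) (m+n∸n≡m e (3 * n)) ⟩
    r p (+ e)                    ≡⟨ r-pos p e<p ⟩
    e                            ∎)
    where
    open ≡-Reasoning
    j e : ℕ
    j = p + 2 ∸ k
    e = n + 2 ∸ k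
    k≤p+1 : k ≤ p + 1
    k≤p+1 = ≤-trans k≤n+2 (subst (n + 2 ≤_) (sym p+1≡4n)
              (+-monoʳ-≤ n (≤-trans (s≤s (s≤s z≤n)) (*-monoʳ-≤ 3 1≤n))))
    k≤p+2 : k ≤ p + 2
    k≤p+2 = ≤-trans k≤p+1 (+-monoʳ-≤ p (n≤1+n 1))
    j+k≡p+2 : j + k ≡ p + 2
    j+k≡p+2 = m∸n+n≡m k≤p+2
    1≤j : 1 ≤ j
    1≤j = m<n⇒0<n∸m (≤-<-trans k≤p+1 (+-monoʳ-< p (n<1+n 1)))
    p+3≡n+2+3n : p + 2 + 1 ≡ n + 2 + 3 * n
    p+3≡n+2+3n = trans (shift p) (trans (cong (_+ 2) p+1≡4n) (regroup n))
      where
      shift : ∀ p → p + 2 + 1 ≡ p + 1 + 2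
      shift = solve-∀
      regroup : ∀ n → 4 * n + 2 ≡ n + 2 + 3 * n
      regroup = solve-∀
    j+1≡e+3n : j + 1 ≡ e + 3 * n
    j+1≡e+3n = begin
      p + 2 ∸ k + 1     ≡⟨ +-∸-comm 1 k≤p+2 ⟨
      p + 2 + 1 ∸ k     ≡⟨ cong (_∸ k) p+3≡n+2+3n ⟩
      n + 2 + 3 * n ∸ k ≡⟨ +-∸-comm (3 * n) k≤n+2 ⟩
      e + 3 * n         ∎
    3n≤j+1 : 3 * n ≤ j + 1
    3n≤j+1 = subst (3 * n ≤_) (sym j+1≡e+3n) (m≤n+m (3 * n) e)
    e<p : e < p
    e<p = subst (e <_) ([3n+k∸3]+[n+2∸k]≡p k k≤n+2)
            (m<n+m e (m<n⇒0<n∸m (+-mono-≤ (*-monoʳ-≤ 3 1≤n) 1≤k)))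

  Γ[k]<p : ∀ k → k + 1 < 3 * n → sqRem p k < 3 * n ∸ k ∸ 1 → Γ n k < p
  Γ[k]<p k k+1<3n ρ<a = subst (_< p) (sym (Γ[k]≡ρ+[n+k] k k+1<3n))
    (+-<-complement ([3n∸k∸1]+[n+k]≡p k (<⇒≤ k+1<3n)) ρ<a)

  p≤Γ[k] : ∀ k → k + 1 < 3 * n → 3 * n ∸ k ∸ 1 ≤ sqRem p k → p ≤ Γ n k
  p≤Γ[k] k k+1<3n a≤ρ = subst (p ≤_) (sym (Γ[k]≡ρ+[n+k] k k+1<3n))
    (+-≥-complement ([3n∸k∸1]+[n+k]≡p k (<⇒≤ k+1<3n)) a≤ρ)

  Γ[p+2∸k]<p : ∀ k → 1 ≤ k → k ≤ n + 2 → sqRem p k < 3 * n + k ∸ 3 → Γ n (p + 2 ∸ k) < p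
  Γ[p+2∸k]<p k 1≤k k≤n+2 ρ<b = subst (_< p) (sym (Γ[p+2∸k]≡ρ+[n+2∸k] k 1≤k k≤n+2))
    (+-<-complement ([3n+k∸3]+[n+2∸k]≡p k k≤n+2) ρ<b)

  p≤Γ[p+2∸k] : ∀ k → 1 ≤ k → k ≤ n + 2 → 3 * n + k ∸ 3 ≤ sqRem p k → p ≤ Γ n (p + 2 ∸ k)
  p≤Γ[p+2∸k] k 1≤k k≤n+2 b≤ρ = subst (p ≤_) (sym (Γ[p+2∸k]≡ρ+[n+2∸k] k 1≤k k≤n+2))
    (+-≥-complement ([3n+k∸3]+[n+2∸k]≡p k k≤n+2) b≤ρ)

lemma2p10 : (n : ℕ) → 2 ≤ n → (prime : Prime (4 * n ∸ 1)) → (k : ℕ) → 2 ≤ k → k ≤ n + 2 →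
    let p = 4 * n ∸ 1 in
    .{{_ : NonZero p}} →
    let ρ = r p ((+ k - + 1) Data.Integer.* (+ k - + 1)) in
    (ρ < 3 * n ∸ k ∸ 1 → Γ n k < p × Γ n (p + 2 ∸ k) < p)
    × (3 * n ∸ k ∸ 1 ≤ ρ → ρ < 3 * n + k ∸ 3 → Γ n (p + 2 ∸ k) < p × p ≤ Γ n k)
    × (3 * n + k ∸ 3 ≤ ρ → p ≤ Γ n (p + 2 ∸ k) × p ≤ Γ n k)
lemma2p10 n 2≤n _ k 2≤k k≤n+2 =
    (λ ρ<a → Γ[k]<p k k+1<3n ρ<a , Γ[p+2∸k]<p k 1≤k k≤n+2 (<-≤-trans ρ<a a≤b))
  , (λ a≤ρ ρ<b → Γ[p+2∸k]<p k 1≤k k≤n+2 ρ<b , p≤Γ[k] k k+1<3n a≤ρ)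
  , (λ b≤ρ → p≤Γ[p+2∸k] k 1≤k k≤n+2 b≤ρ , p≤Γ[k] k k+1<3n (≤-trans a≤b b≤ρ))
  where
  1≤n : 1 ≤ n
  1≤n = ≤-trans (n≤1+n 1) 2≤n
  open Γ-values n 1≤n
  1≤k : 1 ≤ k
  1≤k = ≤-trans (n≤1+n 1) 2≤k
  k+1<3n : k + 1 < 3 * n
  k+1<3n = subst (_≤ 3 * n) (+-suc k 1) (≤-trans (+-monoˡ-≤ 2 k≤n+2)
             (subst (_≤ 3 * n) (sym (+-assoc n 2 2)) (+-monoʳ-≤ n (*-monoʳ-≤ 2 2≤n))))
  a≤b : 3 * n ∸ k ∸ 1 ≤ 3 * n + k ∸ 3
  a≤b = subst (_≤ 3 * n + k ∸ 3) (sym (∸-+-assoc (3 * n) k 1))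
          (∸-mono (m≤m+n (3 * n) k) (+-monoˡ-≤ 1 2≤k))
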